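{- Let $n,m\in\mathbb{Z}^+$ with $m\geq 3$ and $n\geq 2$, and let $C_m$ be the cycle on $m$ vertices. Then $\chi_n(C_m) = \chi(C_m)$.
   Context: For a graph $G=(V,E)$, a $\mathbb{Z}$-labeling is a map $\ell:V\to\mathbb{Z}$; its order is the size of its range; it is proper if adjacent vertices get different labels; $\chi(G)$ is the minimum order of a proper labeling. $N[v]$ is the closed neighborhood of $v$. A closed coloring with nonzero remainders mod $n$ is a labeling with $\sum_{w\in N[v]}\ell(w)\not\equiv 0 \pmod n$ for all $v\in V$. $\chi_n(G)$ denotes the minimum order of a proper closed coloring with nonzero remainders mod $n$ of $G$. -}

module Defs where

open import Data.Nat using (ℕ; suc; _≡ᵇ_; _≤_; _%_; NonZero)
open import Data.Bool using (Bool; _∨_; true; false)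
open import Data.Fin using (Fin; toℕ)
open import Data.Fin.Properties using () renaming (_≟_ to _≟ᶠ_)
open import Data.Integer using (ℤ; +_)
import Data.Integer as ℤ
open import Data.Integer.Divisibility using (_∣_)
open import Data.List using (List; length; map; filterᵇ; allFin; deduplicate; foldr)
open import Data.Product using (Σ; _×_)
open import Relation.Nullary using (¬_; does)
open import Relation.Binary.PropositionalEquality using (_≡_)

record Graph (k : ℕ) : Set where
  field
    adj : Fin k → Fin k → Bool

open Graph public

Labeling : ℕ → Set
Labeling k = Fin k → ℤ

order : ∀ {k} → Labeling k → ℕ
order {k} ℓ = length (deduplicate ℤ._≟_ (map ℓ (allFin k)))

Proper : ∀ {k} → Graph k → Labeling k → Set
Proper {k} G ℓ = ∀ (u v : Fin k) → adj G u v ≡ true → ¬ (ℓ u ≡ ℓ v)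

sumℤ : List ℤ → ℤ
sumℤ = foldr ℤ._+_ (+ 0)

closedNbhd : ∀ {k} → Graph k → Fin k → List (Fin k)
closedNbhd {k} G v = filterᵇ (λ w → does (v ≟ᶠ w) ∨ adj G v w) (allFin k)

ClosedColoringMod : ∀ {k} → ℕ → Graph k → Labeling k → Set
ClosedColoringMod {k} n G ℓ =
  ∀ (v : Fin k) → ¬ ((+ n) ∣ sumℤ (map ℓ (closedNbhd G v)))

IsMinOrder : ∀ {k} → (Labeling k → Set) → ℕ → Set
IsMinOrder {k} P r =
  (Σ (Labeling k) (λ ℓ → P ℓ × order ℓ ≡ r)) ×
  (∀ (ℓ : Labeling k) → P ℓ → r ≤ order ℓ)

IsChromaticNumber : ∀ {k} → Graph k → ℕ → Set
IsChromaticNumber G r = IsMinOrder (Proper G) r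

IsChiN : ∀ {k} → ℕ → Graph k → ℕ → Set
IsChiN n G r = IsMinOrder (λ ℓ → Proper G ℓ × ClosedColoringMod n G ℓ) r

cycle : (m : ℕ) → .{{NonZero m}} → Graph m
cycle m = record
  { adj = λ i j → (((suc (toℕ i)) % m) ≡ᵇ toℕ j) ∨ (((suc (toℕ j)) % m) ≡ᵇ toℕ i) }

-- A proper labeling of C_m needs two values, and three when m is odd: with only
-- two values a proper labeling alternates along the cycle, which an odd cycle
-- cannot do all the way round.  Both bounds are attained by closed colorings.
-- Label vertex i by (-1)^i and, when m is odd, relabel vertex 0 by n + 1; this
-- makes the labeling proper without changing it modulo n.  A closed
-- neighbourhood is three consecutive vertices, and at most one of its two steps
-- wraps around the cycle.  Across a step that does not wrap the two labels are
-- opposite signs modulo n and cancel, so every closed sum is ±1 modulo n, which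
-- n ≥ 2 does not divide.

module Submission where

open import Defs
open import Data.Bool using (Bool; true; T; _∨_)
open import Data.Bool.Properties using (T-∨; T-≡)
open import Data.Empty using (⊥-elim)
open import Data.Fin using (Fin; zero; suc; toℕ; fromℕ<)
open import Data.Fin.Properties
  using (toℕ-fromℕ<; toℕ-injective; toℕ<n; injective⇒≤; any?)
  renaming (_≟_ to _≟ᶠ_)
open import Data.Integer as ℤ using (ℤ; +_; 0ℤ; 1ℤ; -1ℤ; -_; _-_)
import Data.Integer.Properties as ℤ
open import Data.Integer.Divisibility using (_∣_)
import Data.Integer.Divisibility.Signed as Signed
open import Data.Integer.Tactic.RingSolver using (solve-∀)
open import Data.List using (List; []; _∷_; map; length; lookup; allFin; deduplicate)
open import Data.List.Membership.Propositional using (_∈_)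
open import Data.List.Membership.Propositional.Properties
  using (∈-lookup; ∈-map⁺; ∈-map⁻; ∈-allFin; ∈-deduplicate⁺; ∈-deduplicate⁻; ∈-filter⁺; ∈-filter⁻)
open import Data.List.Membership.Propositional.Properties.WithK using (unique∧set⇒bag)
open import Data.List.Relation.Binary.BagAndSetEquality using (∼bag⇒↭)
open import Data.List.Relation.Binary.Permutation.Propositional using (_↭_; ↭⇒↭ₛ)
import Data.List.Relation.Binary.Permutation.Propositional.Properties as ↭
open import Data.List.Relation.Binary.Permutation.Setoid.Properties using (foldr-commMonoid)
open import Data.List.Relation.Binary.Subset.Propositional using (_⊆_)
open import Data.List.Relation.Unary.All as All using (All; []; _∷_)
open import Data.List.Relation.Unary.AllPairs using ([]; _∷_)
open import Data.List.Relation.Unary.Any using (here; there; index)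
open import Data.List.Relation.Unary.Any.Properties using (lookup-index)
open import Data.List.Relation.Unary.Unique.Propositional using (Unique)
open import Data.List.Relation.Unary.Unique.Propositional.Properties using (allFin⁺; filter⁺)
open import Data.List.Relation.Unary.Unique.DecPropositional.Properties using (deduplicate-!)
open import Data.Nat using (ℕ; zero; suc; pred; _+_; _≤_; _<_; _%_; _≡ᵇ_; NonZero; s≤s; z≤n)
import Data.Nat.Properties as ℕ
open import Data.Nat.DivMod using (m%n<n; m<n⇒m%n≡m; n%n≡0; m%n%n≡m%n; %-distribˡ-+; %-remove-+ˡ)
import Data.Nat.Divisibility as ℕ
open import Data.Product using (Σ; ∃; _×_; _,_; proj₁; proj₂)
open import Data.Sum as Sum using (_⊎_; inj₁; inj₂)
open import Function using (_∘_; _⇔_; mk⇔; Equivalence)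
open import Relation.Nullary using (¬_; yes; no; does)
open import Relation.Nullary.Decidable using (T?; dec-true; ¬?; _×-dec_)
open import Relation.Binary.PropositionalEquality

private
  variable
    A : Set
    k n : ℕ

private
  +-cancel-neg-first : ∀ a c → a ℤ.+ (- a ℤ.+ (c ℤ.+ 0ℤ)) ≡ c
  +-cancel-neg-first = solve-∀

  +-cancel-neg-last : ∀ a b → a ℤ.+ (b ℤ.+ (- b ℤ.+ 0ℤ)) ≡ a
  +-cancel-neg-last = solve-∀

  difference-of-sums : ∀ a b c d → (a ℤ.+ c) - (b ℤ.+ d) ≡ (a - b) ℤ.+ (c - d)
  difference-of-sums = solve-∀

  minus-difference : ∀ a b → a - (a - b) ≡ b
  minus-difference = solve-∀

two-valued-≢⇒≡ : {a b x y z : A} → x ≡ a ⊎ x ≡ b → y ≡ a ⊎ y ≡ b → z ≡ a ⊎ z ≡ b →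
  x ≢ y → z ≢ y → x ≡ z
two-valued-≢⇒≡ (inj₁ refl) (inj₁ refl) _           x≢y _   = ⊥-elim (x≢y refl)
two-valued-≢⇒≡ (inj₁ refl) (inj₂ refl) (inj₁ refl) _   _   = refl
two-valued-≢⇒≡ (inj₁ refl) (inj₂ refl) (inj₂ refl) _   z≢y = ⊥-elim (z≢y refl)
two-valued-≢⇒≡ (inj₂ refl) (inj₁ refl) (inj₁ refl) _   z≢y = ⊥-elim (z≢y refl)
two-valued-≢⇒≡ (inj₂ refl) (inj₁ refl) (inj₂ refl) _   _   = refl
two-valued-≢⇒≡ (inj₂ refl) (inj₂ refl) _           x≢y _   = ⊥-elim (x≢y refl)

Unique-lookup-injective : {xs : List A} → Unique xs → ∀ {i j} → lookup xs i ≡ lookup xs j → i ≡ j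
Unique-lookup-injective (_ ∷ _)   {zero}  {zero}  _  = refl
Unique-lookup-injective (x∉ ∷ _)  {zero}  {suc j} eq = ⊥-elim (All.lookup x∉ (∈-lookup j) eq)
Unique-lookup-injective (x∉ ∷ _)  {suc i} {zero}  eq = ⊥-elim (All.lookup x∉ (∈-lookup i) (sym eq))
Unique-lookup-injective (_ ∷ uniq) {suc i} {suc j} eq = cong suc (Unique-lookup-injective uniq eq)

Unique⇒length≤ : {xs ys : List A} → Unique xs → xs ⊆ ys → length xs ≤ length ys
Unique⇒length≤ {xs = xs} {ys} uniq xs⊆ys = injective⇒≤ position-injective
  where
  position : Fin (length xs) → Fin (length ys)
  position i = index (xs⊆ys (∈-lookup i))

  position-injective : ∀ {i j} → position i ≡ position j → i ≡ j
  position-injective {i} {j} eq = Unique-lookup-injective uniq (begin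
    lookup xs i             ≡⟨ lookup-index (xs⊆ys (∈-lookup i)) ⟩
    lookup ys (position i)  ≡⟨ cong (lookup ys) eq ⟩
    lookup ys (position j)  ≡⟨ lookup-index (xs⊆ys (∈-lookup j)) ⟨
    lookup xs j             ∎)
    where open ≡-Reasoning

Value : Labeling k → ℤ → Set
Value ℓ x = ∃ λ w → ℓ w ≡ x

order-≤ : (ℓ : Labeling k) {xs : List ℤ} → (∀ w → ℓ w ∈ xs) → order ℓ ≤ length xs
order-≤ ℓ ℓ∈xs = Unique⇒length≤ (deduplicate-! ℤ._≟_ _) range⊆xs
  where
  range⊆xs : deduplicate ℤ._≟_ (map ℓ (allFin _)) ⊆ _
  range⊆xs x∈ with ∈-map⁻ ℓ (∈-deduplicate⁻ ℤ._≟_ _ x∈)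
  ... | w , _ , refl = ℓ∈xs w

≤-order : (ℓ : Labeling k) {xs : List ℤ} → Unique xs → All (Value ℓ) xs → length xs ≤ order ℓ
≤-order ℓ uniq values = Unique⇒length≤ uniq xs⊆range
  where
  xs⊆range : _ ⊆ deduplicate ℤ._≟_ (map ℓ (allFin _))
  xs⊆range x∈ with All.lookup values x∈
  ... | w , refl = ∈-deduplicate⁺ ℤ._≟_ (∈-map⁺ ℓ (∈-allFin w))

order-≡ : (ℓ : Labeling k) {xs : List ℤ} →
  Unique xs → All (Value ℓ) xs → (∀ w → ℓ w ∈ xs) → order ℓ ≡ length xs
order-≡ ℓ uniq values ℓ∈xs = ℕ.≤-antisym (order-≤ ℓ ℓ∈xs) (≤-order ℓ uniq values)

sumℤ-↭ : {xs ys : List ℤ} → xs ↭ ys → sumℤ xs ≡ sumℤ ys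
sumℤ-↭ xs↭ys = foldr-commMonoid (setoid ℤ) ℤ.+-0-isCommutativeMonoid (↭⇒↭ₛ xs↭ys)

∣-sumℤ-map-difference : ∀ {d} (f g : A → ℤ) → (∀ x → d Signed.∣ f x - g x) →
  ∀ xs → d Signed.∣ sumℤ (map f xs) - sumℤ (map g xs)
∣-sumℤ-map-difference f g d∣f-g [] = Signed.∣ᵤ⇒∣ (ℕ._∣0 _)
∣-sumℤ-map-difference {d = d} f g d∣f-g (x ∷ xs) =
  subst (d Signed.∣_) (sym (difference-of-sums (f x) (g x) _ _))
    (Signed.∣m∣n⇒∣m+n (d∣f-g x) (∣-sumℤ-map-difference f g d∣f-g xs))

ClosedColoringMod-resp-≡-mod : {G : Graph k} (ℓ ℓ′ : Labeling k) → (∀ v → + n ∣ ℓ v - ℓ′ v) →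
  ClosedColoringMod n G ℓ′ → ClosedColoringMod n G ℓ
ClosedColoringMod-resp-≡-mod {n = n} {G = G} ℓ ℓ′ ℓ≡ℓ′ closed v n∣Σℓ = closed v (Signed.∣⇒∣ᵤ n∣Σℓ′)
  where
  Σℓ Σℓ′ : ℤ
  Σℓ = sumℤ (map ℓ (closedNbhd G v))
  Σℓ′ = sumℤ (map ℓ′ (closedNbhd G v))

  n∣Σℓ-Σℓ′ : + n Signed.∣ Σℓ - Σℓ′
  n∣Σℓ-Σℓ′ = ∣-sumℤ-map-difference ℓ ℓ′ (Signed.∣ᵤ⇒∣ ∘ ℓ≡ℓ′) (closedNbhd G v)

  n∣Σℓ′ : + n Signed.∣ Σℓ′
  n∣Σℓ′ = subst (+ n Signed.∣_) (minus-difference Σℓ Σℓ′)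
    (Signed.∣m∣n⇒∣m-n {m = Σℓ} (Signed.∣ᵤ⇒∣ n∣Σℓ) n∣Σℓ-Σℓ′)

optimal-closed-coloring⇒χ≡χₙ : {G : Graph k} {r : ℕ} (ℓ : Labeling k) →
  Proper G ℓ → ClosedColoringMod n G ℓ → order ℓ ≡ r → (∀ ℓ′ → Proper G ℓ′ → r ≤ order ℓ′) →
  IsChromaticNumber G r × IsChiN n G r
optimal-closed-coloring⇒χ≡χₙ ℓ proper closed order≡r optimal =
    ((ℓ , proper , order≡r) , optimal)
  , ((ℓ , (proper , closed) , order≡r) , λ ℓ′ → optimal ℓ′ ∘ proj₁)

module _ {m : ℕ} .{{_ : NonZero m}} where

  vertex : ℕ → Fin m
  vertex j = fromℕ< (m%n<n j m)

  next prev : Fin m → Fin m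
  next u = vertex (suc (toℕ u))
  prev u = vertex (pred m + toℕ u)

  window : Fin m → List (Fin m)
  window u = u ∷ next u ∷ next (next u) ∷ []

  toℕ-vertex : ∀ j → toℕ (vertex j) ≡ j % m
  toℕ-vertex j = toℕ-fromℕ< _

  toℕ-vertex-< : ∀ {j} → j < m → toℕ (vertex j) ≡ j
  toℕ-vertex-< j<m = trans (toℕ-vertex _) (m<n⇒m%n≡m j<m)

  vertex-toℕ : ∀ u → vertex (toℕ u) ≡ u
  vertex-toℕ u = toℕ-injective (toℕ-vertex-< (toℕ<n u))

  vertex-+% : ∀ i j → vertex (i + j % m) ≡ vertex (i + j)
  vertex-+% i j = toℕ-injective (begin
    toℕ (vertex (i + j % m))  ≡⟨ toℕ-vertex _ ⟩
    (i + j % m) % m           ≡⟨ %-distribˡ-+ i (j % m) m ⟩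
    (i % m + j % m % m) % m   ≡⟨ cong (λ x → (i % m + x) % m) (m%n%n≡m%n j m) ⟩
    (i % m + j % m) % m       ≡⟨ %-distribˡ-+ i j m ⟨
    (i + j) % m               ≡⟨ toℕ-vertex _ ⟨
    toℕ (vertex (i + j))      ∎)
    where open ≡-Reasoning

  vertex-m+ : ∀ j → vertex (m + j) ≡ vertex j
  vertex-m+ j = toℕ-injective (begin
    toℕ (vertex (m + j))  ≡⟨ toℕ-vertex _ ⟩
    (m + j) % m           ≡⟨ %-remove-+ˡ j ℕ.∣-refl ⟩
    j % m                 ≡⟨ toℕ-vertex _ ⟨
    toℕ (vertex j)        ∎)
    where open ≡-Reasoning

  next-vertex : ∀ j → next (vertex j) ≡ vertex (suc j)
  next-vertex j = trans (cong (vertex ∘ suc) (toℕ-vertex j)) (vertex-+% 1 j)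

  next-prev : ∀ u → next (prev u) ≡ u
  next-prev u = begin
    next (prev u)                  ≡⟨ next-vertex (pred m + toℕ u) ⟩
    vertex (suc (pred m) + toℕ u)  ≡⟨ cong (λ x → vertex (x + toℕ u)) (ℕ.suc-pred m) ⟩
    vertex (m + toℕ u)             ≡⟨ vertex-m+ (toℕ u) ⟩
    vertex (toℕ u)                 ≡⟨ vertex-toℕ u ⟩
    u                              ∎
    where open ≡-Reasoning

  prev-next : ∀ u → prev (next u) ≡ u
  prev-next u = begin
    prev (next u)                      ≡⟨ cong (λ x → vertex (pred m + x)) (toℕ-vertex (suc (toℕ u))) ⟩
    vertex (pred m + suc (toℕ u) % m)  ≡⟨ vertex-+% (pred m) (suc (toℕ u)) ⟩
    vertex (pred m + suc (toℕ u))      ≡⟨ cong vertex (ℕ.+-suc (pred m) (toℕ u)) ⟩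
    vertex (suc (pred m) + toℕ u)      ≡⟨ cong (λ x → vertex (x + toℕ u)) (ℕ.suc-pred m) ⟩
    vertex (m + toℕ u)                 ≡⟨ vertex-m+ (toℕ u) ⟩
    vertex (toℕ u)                     ≡⟨ vertex-toℕ u ⟩
    u                                  ∎
    where open ≡-Reasoning

  next-injective : ∀ {u w} → next u ≡ next w → u ≡ w
  next-injective {u} {w} eq = trans (sym (prev-next u)) (trans (cong prev eq) (prev-next w))

  toℕ-next-cases : ∀ u → toℕ (next u) ≡ suc (toℕ u) ⊎ (toℕ (next u) ≡ 0 × suc (toℕ u) ≡ m)
  toℕ-next-cases u with ℕ.m≤n⇒m<n∨m≡n (toℕ<n u)
  ... | inj₁ 1+u<m = inj₁ (trans (toℕ-vertex _) (m<n⇒m%n≡m 1+u<m))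
  ... | inj₂ 1+u≡m = inj₂ (trans (toℕ-vertex _) (trans (cong (_% m) 1+u≡m) (n%n≡0 m)) , 1+u≡m)

  next-wraps-at-most-once : 2 ≤ m → ∀ u →
    toℕ (next u) ≡ suc (toℕ u) ⊎ toℕ (next (next u)) ≡ suc (toℕ (next u))
  next-wraps-at-most-once 2≤m u with toℕ-next-cases u
  ... | inj₁ nu≡1+u = inj₁ nu≡1+u
  ... | inj₂ (nu≡0 , _) with toℕ-next-cases (next u)
  ...   | inj₁ nnu≡1+nu = inj₂ nnu≡1+nu
  ...   | inj₂ (_ , 1+nu≡m) = ⊥-elim (ℕ.<⇒≢ 2≤m (trans (cong suc (sym nu≡0)) 1+nu≡m))

  T-next : ∀ u w → T (suc (toℕ u) % m ≡ᵇ toℕ w) ⇔ next u ≡ w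
  T-next u w = mk⇔
    (λ t → toℕ-injective (trans (toℕ-vertex _) (ℕ.≡ᵇ⇒≡ _ _ t)))
    (λ eq → ℕ.≡⇒≡ᵇ _ _ (trans (sym (toℕ-vertex _)) (cong toℕ eq)))

  adj-cycle : ∀ u w → adj (cycle m) u w ≡ true ⇔ (next u ≡ w ⊎ next w ≡ u)
  adj-cycle u w = mk⇔
    (Sum.map (to (T-next u w)) (to (T-next w u)) ∘ to T-∨ ∘ from T-≡)
    (to T-≡ ∘ from T-∨ ∘ Sum.map (from (T-next u w)) (from (T-next w u)))
    where open Equivalence

  adj-next : ∀ u → adj (cycle m) u (next u) ≡ true
  adj-next u = Equivalence.from (adj-cycle u (next u)) (inj₁ refl)

  next-≢ : 2 ≤ m → ∀ u → u ≢ next u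
  next-≢ 2≤m u u≡nu with cong toℕ u≡nu | toℕ-next-cases u
  ... | eq | inj₁ nu≡1+u         = ℕ.1+n≢n (sym (trans eq nu≡1+u))
  ... | eq | inj₂ (nu≡0 , 1+u≡m) = ℕ.<⇒≢ 2≤m (trans (cong suc (sym (trans eq nu≡0))) 1+u≡m)

  next²-≢ : 3 ≤ m → ∀ u → u ≢ next (next u)
  next²-≢ 3≤m u u≡nnu with cong toℕ u≡nnu | toℕ-next-cases u | toℕ-next-cases (next u)
  ... | eq | inj₁ nu≡1+u | inj₁ nnu≡1+nu =
    ℕ.m+1+n≢n 1 (sym (trans eq (trans nnu≡1+nu (cong suc nu≡1+u))))
  ... | eq | inj₁ nu≡1+u | inj₂ (nnu≡0 , 1+nu≡m) = ℕ.<⇒≢ 3≤m (begin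
    2                   ≡⟨ cong (λ i → 2 + i) (trans eq nnu≡0) ⟨
    2 + toℕ u           ≡⟨ cong suc nu≡1+u ⟨
    suc (toℕ (next u))  ≡⟨ 1+nu≡m ⟩
    m                   ∎)
    where open ≡-Reasoning
  ... | eq | inj₂ (nu≡0 , 1+u≡m) | inj₁ nnu≡1+nu = ℕ.<⇒≢ 3≤m (begin
    2                          ≡⟨ cong (λ i → 2 + i) nu≡0 ⟨
    2 + toℕ (next u)           ≡⟨ cong suc nnu≡1+nu ⟨
    suc (toℕ (next (next u)))  ≡⟨ cong suc eq ⟨
    suc (toℕ u)                ≡⟨ 1+u≡m ⟩
    m                          ∎)
    where open ≡-Reasoning
  ... | _ | inj₂ (nu≡0 , _) | inj₂ (_ , 1+nu≡m) =
    ℕ.<⇒≢ (ℕ.<⇒≤ 3≤m) (trans (cong suc (sym nu≡0)) 1+nu≡m)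

  window-unique : 3 ≤ m → ∀ u → Unique (window u)
  window-unique 3≤m u =
    (next-≢ 2≤m u ∷ next²-≢ 3≤m u ∷ []) ∷ (next-≢ 2≤m (next u) ∷ []) ∷ [] ∷ []
    where 2≤m = ℕ.<⇒≤ 3≤m

  ∈-closedNbhd-next : ∀ u w → w ∈ closedNbhd (cycle m) (next u) ⇔ w ∈ window u
  ∈-closedNbhd-next u w = mk⇔ to from
    where
    open Equivalence using () renaming (to to ⇒; from to ⇐)
    member? : Fin m → Bool
    member? w = does (next u ≟ᶠ w) ∨ adj (cycle m) (next u) w

    member⇒ : T (does (next u ≟ᶠ w) ∨ adj (cycle m) (next u) w) → w ∈ window u
    member⇒ t with next u ≟ᶠ w
    ... | yes nu≡w = there (here (sym nu≡w))
    ... | no _ with ⇒ (adj-cycle (next u) w) (⇒ T-≡ t)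
    ...   | inj₁ nnu≡w = there (there (here (sym nnu≡w)))
    ...   | inj₂ nw≡nu = here (next-injective nw≡nu)

    to : w ∈ closedNbhd (cycle m) (next u) → w ∈ window u
    to w∈ = member⇒ (proj₂ (∈-filter⁻ (T? ∘ member?) {xs = allFin m} w∈))

    member⇐ : does (next u ≟ᶠ w) ≡ true ⊎ adj (cycle m) (next u) w ≡ true →
      w ∈ closedNbhd (cycle m) (next u)
    member⇐ t = ∈-filter⁺ (T? ∘ member?) (∈-allFin w)
      (⇐ (T-∨ {does (next u ≟ᶠ w)}) (Sum.map (⇐ T-≡) (⇐ T-≡) t))

    from : w ∈ window u → w ∈ closedNbhd (cycle m) (next u)
    from (here refl) = member⇐ (inj₂ (⇐ (adj-cycle (next u) u) (inj₂ refl)))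
    from (there (here refl)) = member⇐ (inj₁ (dec-true (next u ≟ᶠ next u) refl))
    from (there (there (here refl))) = member⇐ (inj₂ (adj-next (next u)))

  closedNbhd-next↭window : 3 ≤ m → ∀ u → closedNbhd (cycle m) (next u) ↭ window u
  closedNbhd-next↭window 3≤m u = ∼bag⇒↭ (unique∧set⇒bag
    (filter⁺ _ (allFin⁺ m)) (window-unique 3≤m u) (λ {w} → ∈-closedNbhd-next u w))

  Proper-cycle⁺ : (ℓ : Labeling m) → (∀ u → ℓ u ≢ ℓ (next u)) → Proper (cycle m) ℓ
  Proper-cycle⁺ ℓ distinct u w adjacent with Equivalence.to (adj-cycle u w) adjacent
  ... | inj₁ refl = distinct u
  ... | inj₂ refl = distinct w ∘ sym

  Proper-cycle⁻ : {ℓ : Labeling m} → Proper (cycle m) ℓ → ∀ u → ℓ u ≢ ℓ (next u)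
  Proper-cycle⁻ proper u = proper u (next u) (adj-next u)

  ClosedColoringMod-cycle⁺ : 3 ≤ m → (ℓ : Labeling m) →
    (∀ u → ¬ (+ n ∣ sumℤ (map ℓ (window u)))) → ClosedColoringMod n (cycle m) ℓ
  ClosedColoringMod-cycle⁺ {n} 3≤m ℓ window-sums v =
    subst (λ v → ¬ (+ n ∣ sumℤ (map ℓ (closedNbhd (cycle m) v)))) (next-prev v)
      (window-sums (prev v) ∘ subst (+ n ∣_)
        (sumℤ-↭ (↭.map⁺ ℓ (closedNbhd-next↭window 3≤m (prev v)))))

  Proper-cycle⁻-vertex : {ℓ : Labeling m} → Proper (cycle m) ℓ →
    ∀ j → ℓ (vertex j) ≢ ℓ (vertex (suc j))
  Proper-cycle⁻-vertex {ℓ} proper j =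
    subst (λ v → ℓ (vertex j) ≢ ℓ v) (next-vertex j) (Proper-cycle⁻ proper (vertex j))

  Proper-cycle⇒2≤order : (ℓ : Labeling m) → Proper (cycle m) ℓ → 2 ≤ order ℓ
  Proper-cycle⇒2≤order ℓ proper =
    ≤-order ℓ ((Proper-cycle⁻-vertex proper 0 ∷ []) ∷ [] ∷ [])
      ((vertex 0 , refl) ∷ (vertex 1 , refl) ∷ [])

module _ {m : ℕ} .{{_ : NonZero m}} {ℓ : Labeling m} (proper : Proper (cycle m) ℓ) where

  two-valued⇒period-2 : {a b : ℤ} → (∀ w → ℓ w ≡ a ⊎ ℓ w ≡ b) →
    ∀ t → ℓ (vertex (t + t)) ≡ ℓ (vertex 0)
  two-valued⇒period-2 two-valued zero = refl
  two-valued⇒period-2 two-valued (suc t) = begin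
    ℓ (vertex (suc (t + suc t)))  ≡⟨ cong (λ j → ℓ (vertex (suc j))) (ℕ.+-suc t t) ⟩
    ℓ (vertex (2 + (t + t)))      ≡⟨ two-steps (t + t) ⟨
    ℓ (vertex (t + t))            ≡⟨ two-valued⇒period-2 two-valued t ⟩
    ℓ (vertex 0)                  ∎
    where
    open ≡-Reasoning
    two-steps : ∀ j → ℓ (vertex j) ≡ ℓ (vertex (2 + j))
    two-steps j = two-valued-≢⇒≡ (two-valued _) (two-valued _) (two-valued _)
      (Proper-cycle⁻-vertex proper j) (≢-sym (Proper-cycle⁻-vertex proper (suc j)))

  -- m + 1 is even, and m + 1 steps from vertex 0 lead to vertex 1.
  odd-cycle-not-two-valued : {k : ℕ} {a b : ℤ} → m ≡ suc (k + k) → ¬ (∀ w → ℓ w ≡ a ⊎ ℓ w ≡ b)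
  odd-cycle-not-two-valued {k} m≡1+2k two-valued = Proper-cycle⁻-vertex proper 0 (begin
    ℓ (vertex 0)                ≡⟨ two-valued⇒period-2 two-valued (suc k) ⟨
    ℓ (vertex (suc k + suc k))  ≡⟨ cong (ℓ ∘ vertex) (cong suc (trans (ℕ.+-suc k k) (sym m≡1+2k))) ⟩
    ℓ (vertex (suc m))          ≡⟨ cong (ℓ ∘ vertex) (ℕ.+-comm 1 m) ⟩
    ℓ (vertex (m + 1))          ≡⟨ cong ℓ (vertex-m+ 1) ⟩
    ℓ (vertex 1)                ∎)
    where open ≡-Reasoning

  odd-cycle-3≤order : {k : ℕ} → m ≡ suc (k + k) → 3 ≤ order ℓ
  odd-cycle-3≤order {k} m≡1+2k
    with any? (λ w → ¬? (ℓ w ℤ.≟ ℓ (vertex 0)) ×-dec ¬? (ℓ w ℤ.≟ ℓ (vertex 1)))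
  ... | yes (w , w≢u₀ , w≢u₁) = ≤-order ℓ
    ((Proper-cycle⁻-vertex proper 0 ∷ ≢-sym w≢u₀ ∷ []) ∷ (≢-sym w≢u₁ ∷ []) ∷ [] ∷ [])
    ((vertex 0 , refl) ∷ (vertex 1 , refl) ∷ (w , refl) ∷ [])
  ... | no ∄third = ⊥-elim (odd-cycle-not-two-valued {k} m≡1+2k two-valued)
    where
    two-valued : ∀ w → ℓ w ≡ ℓ (vertex 0) ⊎ ℓ w ≡ ℓ (vertex 1)
    two-valued w with ℓ w ℤ.≟ ℓ (vertex 0) | ℓ w ℤ.≟ ℓ (vertex 1)
    ... | yes w≡u₀ | _         = inj₁ w≡u₀
    ... | no _     | yes w≡u₁  = inj₂ w≡u₁
    ... | no w≢u₀  | no w≢u₁   = ⊥-elim (∄third (w , w≢u₀ , w≢u₁))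

IsSign : ℤ → Set
IsSign x = x ≡ 1ℤ ⊎ x ≡ -1ℤ

IsSign⇒≢- : ∀ {x} → IsSign x → x ≢ - x
IsSign⇒≢- (inj₁ refl) ()
IsSign⇒≢- (inj₂ refl) ()

IsSign⇒∤ : 2 ≤ n → ∀ {x} → IsSign x → ¬ (+ n ∣ x)
IsSign⇒∤ 2≤n (inj₁ refl) n∣1 = ℕ.<⇒≢ 2≤n (sym (ℕ.∣1⇒≡1 n∣1))
IsSign⇒∤ 2≤n (inj₂ refl) n∣1 = ℕ.<⇒≢ 2≤n (sym (ℕ.∣1⇒≡1 n∣1))

IsSign⇒∈ : ∀ {x} → IsSign x → x ∈ 1ℤ ∷ -1ℤ ∷ []
IsSign⇒∈ (inj₁ refl) = here refl
IsSign⇒∈ (inj₂ refl) = there (here refl)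

alternating : ℕ → ℤ
alternating zero    = 1ℤ
alternating (suc i) = - alternating i

alternating-sign : ∀ i → IsSign (alternating i)
alternating-sign zero = inj₁ refl
alternating-sign (suc i) with alternating-sign i
... | inj₁ eq = inj₂ (cong -_ eq)
... | inj₂ eq = inj₁ (cong -_ eq)

alternating-≢-suc : ∀ i → alternating i ≢ alternating (suc i)
alternating-≢-suc i = IsSign⇒≢- (alternating-sign i)

alternating-even : ∀ k → alternating (k + k) ≡ 1ℤ
alternating-even zero = refl
alternating-even (suc k) = begin
  - alternating (k + suc k)      ≡⟨ cong (-_ ∘ alternating) (ℕ.+-suc k k) ⟩
  - - alternating (k + k)        ≡⟨ ℤ.neg-involutive _ ⟩
  alternating (k + k)            ≡⟨ alternating-even k ⟩
  1ℤ                             ∎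
  where open ≡-Reasoning

oddCycleLabel : ℕ → ℕ → ℤ
oddCycleLabel n zero    = + suc n
oddCycleLabel n (suc i) = alternating (suc i)

oddCycleLabel-≡-mod : ∀ i → + n ∣ oddCycleLabel n i - alternating i
oddCycleLabel-≡-mod zero    = ℕ.∣-refl
oddCycleLabel-≡-mod (suc i) =
  subst (λ d → + _ ∣ d) (sym (ℤ.+-inverseʳ (alternating (suc i)))) (ℕ._∣0 _)

oddCycleLabel-≢-suc : ∀ i → oddCycleLabel n i ≢ oddCycleLabel n (suc i)
oddCycleLabel-≢-suc zero    ()
oddCycleLabel-≢-suc (suc i) = alternating-≢-suc (suc i)

+1+n≢1 : 1 ≤ n → + suc n ≢ 1ℤ
+1+n≢1 (s≤s _) ()

even-or-odd : ∀ m → (∃ λ k → m ≡ k + k) ⊎ (∃ λ k → m ≡ suc (k + k))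
even-or-odd zero = inj₁ (0 , refl)
even-or-odd (suc m) with even-or-odd m
... | inj₁ (k , m≡2k)   = inj₂ (k , cong suc m≡2k)
... | inj₂ (k , m≡1+2k) = inj₁ (suc k , cong suc (trans m≡1+2k (sym (ℕ.+-suc k k))))

module _ {m : ℕ} .{{_ : NonZero m}} where

  alternatingColoring : Labeling m
  alternatingColoring = alternating ∘ toℕ

  oddCycleColoring : ℕ → Labeling m
  oddCycleColoring n = oddCycleLabel n ∘ toℕ

  alternating-window-sign : 2 ≤ m → ∀ u → IsSign (sumℤ (map alternatingColoring (window u)))
  alternating-window-sign 2≤m u with next-wraps-at-most-once 2≤m u
  ... | inj₁ nu≡1+u = subst IsSign
    (sym (trans (cong (λ i → a ℤ.+ (alternating i ℤ.+ (c ℤ.+ 0ℤ))) nu≡1+u) (+-cancel-neg-first a c)))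
    (alternating-sign (toℕ (next (next u))))
    where
    a = alternating (toℕ u)
    c = alternating (toℕ (next (next u)))
  ... | inj₂ nnu≡1+nu = subst IsSign
    (sym (trans (cong (λ i → a ℤ.+ (b ℤ.+ (alternating i ℤ.+ 0ℤ))) nnu≡1+nu) (+-cancel-neg-last a b)))
    (alternating-sign (toℕ u))
    where
    a = alternating (toℕ u)
    b = alternating (toℕ (next u))

  alternating-next : {k : ℕ} → m ≡ k + k → ∀ u → alternating (toℕ (next u)) ≡ - alternating (toℕ u)
  alternating-next {k} m≡2k u with toℕ-next-cases u
  ... | inj₁ nu≡1+u = cong alternating nu≡1+u
  ... | inj₂ (nu≡0 , 1+u≡m) = begin
    alternating (toℕ (next u))  ≡⟨ cong alternating nu≡0 ⟩
    1ℤ                          ≡⟨ alternating-even k ⟨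
    alternating (k + k)         ≡⟨ cong alternating (trans (sym m≡2k) (sym 1+u≡m)) ⟩
    - alternating (toℕ u)       ∎
    where open ≡-Reasoning

  alternatingColoring-proper : {k : ℕ} → m ≡ k + k → Proper (cycle m) alternatingColoring
  alternatingColoring-proper {k} m≡2k = Proper-cycle⁺ _ λ u →
    subst (alternating (toℕ u) ≢_) (sym (alternating-next {k} m≡2k u)) (alternating-≢-suc (toℕ u))

  alternatingColoring-closed : 3 ≤ m → 2 ≤ n → ClosedColoringMod n (cycle m) alternatingColoring
  alternatingColoring-closed 3≤m 2≤n = ClosedColoringMod-cycle⁺ 3≤m _ λ u →
    IsSign⇒∤ 2≤n (alternating-window-sign (ℕ.<⇒≤ 3≤m) u)

  order-alternatingColoring : 2 ≤ m → order alternatingColoring ≡ 2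
  order-alternatingColoring 2≤m = order-≡ alternatingColoring (((λ ()) ∷ []) ∷ [] ∷ [])
    ( (vertex 0 , cong alternating (toℕ-vertex-< (ℕ.<-trans (s≤s z≤n) 2≤m)))
    ∷ (vertex 1 , cong alternating (toℕ-vertex-< 2≤m)) ∷ [])
    (IsSign⇒∈ ∘ alternating-sign ∘ toℕ)

  oddCycleColoring-proper : {k : ℕ} → m ≡ suc (suc k + suc k) → 1 ≤ n →
    Proper (cycle m) (oddCycleColoring n)
  oddCycleColoring-proper {n = n} {k = k} m≡3+2k 1≤n = Proper-cycle⁺ _ distinct
    where
    distinct : ∀ u → oddCycleLabel n (toℕ u) ≢ oddCycleLabel n (toℕ (next u))
    distinct u with toℕ-next-cases u
    ... | inj₁ nu≡1+u =
      subst (oddCycleLabel n (toℕ u) ≢_) (cong (oddCycleLabel n) (sym nu≡1+u))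
        (oddCycleLabel-≢-suc (toℕ u))
    ... | inj₂ (nu≡0 , 1+u≡m) = λ eq → +1+n≢1 1≤n (begin
      + suc n                         ≡⟨ cong (oddCycleLabel n) nu≡0 ⟨
      oddCycleLabel n (toℕ (next u))  ≡⟨ eq ⟨
      oddCycleLabel n (toℕ u)         ≡⟨ cong (oddCycleLabel n) (ℕ.suc-injective (trans 1+u≡m m≡3+2k)) ⟩
      alternating (suc k + suc k)     ≡⟨ alternating-even (suc k) ⟩
      1ℤ                              ∎)
      where open ≡-Reasoning

  oddCycleColoring-closed : 3 ≤ m → 2 ≤ n → ClosedColoringMod n (cycle m) (oddCycleColoring n)
  oddCycleColoring-closed 3≤m 2≤n = ClosedColoringMod-resp-≡-mod _ alternatingColoring
    (oddCycleLabel-≡-mod ∘ toℕ) (alternatingColoring-closed 3≤m 2≤n)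

  order-oddCycleColoring : 3 ≤ m → 1 ≤ n → order (oddCycleColoring n) ≡ 3
  order-oddCycleColoring {n = n} 3≤m 1≤n = order-≡ (oddCycleColoring n)
    ((+1+n≢1 1≤n ∷ (λ ()) ∷ []) ∷ ((λ ()) ∷ []) ∷ [] ∷ [])
    ( (vertex 0 , cong (oddCycleLabel n) (toℕ-vertex-< (ℕ.≤-trans (s≤s z≤n) 3≤m)))
    ∷ (vertex 2 , cong (oddCycleLabel n) (toℕ-vertex-< 3≤m))
    ∷ (vertex 1 , cong (oddCycleLabel n) (toℕ-vertex-< (ℕ.≤-trans (s≤s (s≤s z≤n)) 3≤m))) ∷ [])
    (labels ∘ toℕ)
    where
    labels : ∀ i → oddCycleLabel n i ∈ + suc n ∷ 1ℤ ∷ -1ℤ ∷ []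
    labels zero    = here refl
    labels (suc i) = there (IsSign⇒∈ (alternating-sign (suc i)))

theorem4p3 : (n m : ℕ) → .{{_ : NonZero m}} → 3 ≤ m → 2 ≤ n →
    Σ ℕ (λ r → IsChromaticNumber (cycle m) r × IsChiN n (cycle m) r)
theorem4p3 n m m≥3 n≥2 with even-or-odd m
... | inj₁ (k , m≡2k) = 2 , optimal-closed-coloring⇒χ≡χₙ alternatingColoring
  (alternatingColoring-proper {k = k} m≡2k)
  (alternatingColoring-closed m≥3 n≥2)
  (order-alternatingColoring (ℕ.<⇒≤ m≥3))
  Proper-cycle⇒2≤order
... | inj₂ (zero , m≡1) = ⊥-elim (ℕ.<⇒≢ (ℕ.<⇒≤ m≥3) (sym m≡1))
... | inj₂ (suc k , m≡3+2k) = 3 , optimal-closed-coloring⇒χ≡χₙ (oddCycleColoring n)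
  (oddCycleColoring-proper {k = k} m≡3+2k n≥1)
  (oddCycleColoring-closed m≥3 n≥2)
  (order-oddCycleColoring m≥3 n≥1)
  (λ ℓ proper → odd-cycle-3≤order proper {k = suc k} m≡3+2k)
  where n≥1 = ℕ.<⇒≤ n≥2
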